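{- For every $\mathrm{PDL}^-$ formula $\varphi$ over term variables $\mathbb A'$ and formula variables $\mathbb P\sqcup\mathbb P'$: if $\varphi$ is derivable in $\mathcal H^-$, then $\Theta_0(\varphi)$ is derivable in $\mathcal H$.
   Context: Let $\mathbb A,\mathbb P,\mathbb A',\mathbb P'$ be pairwise disjoint sets with bijections $\pi_1:\mathbb P'\to\mathbb A$, $\pi_2:\mathbb A'\to\mathbb A$. $\mathrm{PDL}_{\mathrm{REwLA+}}$ (over term variables $B$, formula variables $Q$): formulas $\varphi::=q\mid\varphi\to\varphi\mid\mathtt F\mid[t]\varphi$, terms $t::=b\mid t;t\mid t+t\mid t^+\mid t^{\mathtt a}\mid t^{\cap_{\mathrm{id}}}\mid t^{\cap_{\overline{\mathrm{id}}}}\mid\varphi?$; $\mathrm{PDL}^-$ is the fragment with terms $t::=b\mid t;t\mid t+t\mid t^+\mid\varphi?;t\mid t;\varphi?$. Abbreviations $\neg,\wedge,\vee,\leftrightarrow$, $\mathtt T=\neg\mathtt F$, $\langle t\rangle\varphi=\neg[t]\neg\varphi$, $tu=t;u$. PDL formulas: $\mathrm{PDL}_{\mathrm{REwLA+}}$ formulas not using $\cdot^{\mathtt a},\cdot^{\cap_{\mathrm{id}}},\cdot^{\cap_{\overline{\mathrm{id}}}}$. Semantics in a generalized structure $M$ ($|M|$ nonempty, $U^M\subseteq|M|^2$, $b^M\subseteq U^M$, $q^M\subseteq|M|$): Boolean connectives as usual, $[\![[t]\varphi]\!]=\{x:\forall y((x,y)\in[\![t]\!]\Rightarrow y\in[\![\varphi]\!])\}$,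 $;$ composition, $+$ union, $\cdot^+$ transitive closure, $[\![t^{\mathtt a}]\!]=\{(x,x):\neg\exists y\,(x,y)\in[\![t]\!]\}$, $\cap_{\mathrm{id}}$/$\cap_{\overline{\mathrm{id}}}$ intersect with / remove the identity, $[\![\varphi?]\!]=\{(x,x):x\in[\![\varphi]\!]\}$. $\mathrm{REL}$: structures with $U^M=|M|^2$. $\mathcal H^-$ (for $\mathrm{PDL}^-$ over $(\mathbb A',\mathbb P\sqcup\mathbb P')$): rules modus ponens and necessitation; axioms: substitution instances of propositional tautologies; $[t;u]\varphi\leftrightarrow[t][u]\varphi$; $[t+u]\varphi\leftrightarrow[t]\varphi\wedge[u]\varphi$; $[t^+]\varphi\leftrightarrow([t]\varphi\wedge[t][t^+]\varphi)$; $([t]\varphi\wedge[t^+](\varphi\to[t]\varphi))\to[t^+]\varphi$; $[\psi?;t]\varphi\leftrightarrow(\psi\to[t]\varphi)$; $[t;\psi?]\varphi\leftrightarrow[t](\psi\to\varphi)$; $[t](\varphi\to\psi)\to([t]\varphi\to[t]\psi)$; $[t^+]([t^+]\varphi\to\varphi)\to[t^+]\varphi$. $\mathcal H$ (for $\mathrm{PDL}_{\mathrm{REwLA+}}$ over $(\mathbb A,\mathbb P)$): rules modus ponens and necessitation; axioms (all terms $t,u$, formulas $\varphi,\psi$): all substitution instances of PDL formulas valid on $\mathrm{REL}$; $[t^{\mathtt a}]\varphi\leftrightarrow[[t]\mathtt F?]\varphi$; $[t^{\cap_{\mathrm{id}}}]\varphi\leftrightarrow[\langle t^{\cap_{\mathrm{id}}}\rangle\mathtt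 T?]\varphi$; $[(tu)^{\cap_{\mathrm{id}}}]\varphi\leftrightarrow[t^{\cap_{\mathrm{id}}}u^{\cap_{\mathrm{id}}}]\varphi$; $[(t+u)^{\cap_{\mathrm{id}}}]\varphi\leftrightarrow[t^{\cap_{\mathrm{id}}}+u^{\cap_{\mathrm{id}}}]\varphi$; $[(t^+)^{\cap_{\mathrm{id}}}]\varphi\leftrightarrow[t^{\cap_{\mathrm{id}}}]\varphi$; $[(t^{\mathtt a})^{\cap_{\mathrm{id}}}]\varphi\leftrightarrow[t^{\mathtt a}]\varphi$; $[(t^{\cap_{\mathrm{id}}})^{\cap_{\mathrm{id}}}]\varphi\leftrightarrow[t^{\cap_{\mathrm{id}}}]\varphi$; $[(t^{\cap_{\overline{\mathrm{id}}}})^{\cap_{\mathrm{id}}}]\varphi\leftrightarrow\mathtt T$; $[(\psi?)^{\cap_{\mathrm{id}}}]\varphi\leftrightarrow[\psi?]\varphi$; $[t]\varphi\leftrightarrow[t^{\cap_{\mathrm{id}}}+t^{\cap_{\overline{\mathrm{id}}}}]\varphi$; $[(tu)^{\cap_{\overline{\mathrm{id}}}}]\varphi\leftrightarrow[t^{\cap_{\overline{\mathrm{id}}}}u^{\cap_{\mathrm{id}}}+t^{\cap_{\mathrm{id}}}u^{\cap_{\overline{\mathrm{id}}}}+t^{\cap_{\overline{\mathrm{id}}}}u^{\cap_{\overline{\mathrm{id}}}}]\varphi$; $[(t+u)^{\cap_{\overline{\mathrm{id}}}}]\varphi\leftrightarrow[t^{\cap_{\overline{\mathrm{id}}}}+u^{\cap_{\overline{\mathrm{id}}}}]\varphi$;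 $[(t^+)^{\cap_{\overline{\mathrm{id}}}}]\varphi\leftrightarrow[(t^{\cap_{\overline{\mathrm{id}}}})^+]\varphi$; $[(t^{\mathtt a})^{\cap_{\overline{\mathrm{id}}}}]\varphi\leftrightarrow\mathtt T$; $[(t^{\cap_{\mathrm{id}}})^{\cap_{\overline{\mathrm{id}}}}]\varphi\leftrightarrow\mathtt T$; $[(t^{\cap_{\overline{\mathrm{id}}}})^{\cap_{\overline{\mathrm{id}}}}]\varphi\leftrightarrow[t^{\cap_{\overline{\mathrm{id}}}}]\varphi$; $[(\psi?)^{\cap_{\overline{\mathrm{id}}}}]\varphi\leftrightarrow\mathtt T$; $[(t^{\cap_{\overline{\mathrm{id}}}})^+]([(t^{\cap_{\overline{\mathrm{id}}}})^+]\varphi\to\varphi)\to[(t^{\cap_{\overline{\mathrm{id}}}})^+]\varphi$. $\Theta_0$ maps each $p\in\mathbb P$ to $p$, each $p\in\mathbb P'$ to $\langle\pi_1(p)^{\cap_{\mathrm{id}}}\rangle\mathtt T$, and each $a\in\mathbb A'$ to $\pi_2(a)^{\cap_{\overline{\mathrm{id}}}}$; $\Theta_0(\varphi)$ is the result of applying this substitution to $\varphi$. -}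

module Defs where

open import Data.Nat using (ℕ)
open import Data.Bool using (Bool; true; false; if_then_else_)
open import Data.Sum using (_⊎_; inj₁; inj₂)
open import Data.Product using (Σ; _×_)
open import Data.Empty using (⊥)
open import Relation.Binary.PropositionalEquality using (_≡_)
open import Relation.Binary.Construct.Closure.Transitive using (TransClosure)
open import Axiom.ExcludedMiddle using (ExcludedMiddle)
open import Level using (0ℓ)

data PropF : Set where
  ρv   : ℕ → PropF
  _⇒ᴾ_ : PropF → PropF → PropF
  ρF   : PropF

evalP : (ℕ → Bool) → PropF → Bool
evalP val (ρv n)   = val n
evalP val (a ⇒ᴾ b) = if evalP val a then evalP val b else true
evalP val ρF       = false

Tautology : PropF → Set
Tautology τ = (val : ℕ → Bool) → evalP val τ ≡ true

infixr 5 _⇒_ _⇒⁻_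
mutual
  data Fm (B Q : Set) : Set where
    fv  : Q → Fm B Q
    _⇒_ : Fm B Q → Fm B Q → Fm B Q
    fF  : Fm B Q
    box : Tm B Q → Fm B Q → Fm B Q

  data Tm (B Q : Set) : Set where
    tv    : B → Tm B Q
    _⨾_   : Tm B Q → Tm B Q → Tm B Q
    _⊕_   : Tm B Q → Tm B Q → Tm B Q
    _⁺    : Tm B Q → Tm B Q
    _ᵃ    : Tm B Q → Tm B Q
    _∩id  : Tm B Q → Tm B Q
    _∩nid : Tm B Q → Tm B Q
    _¿    : Fm B Q → Tm B Q

module _ {B Q : Set} where
  infix 6 ¬F_
  infix 4 _⇔_
  infixr 7 _∧F_
  ¬F_ : Fm B Q → Fm B Q
  ¬F φ = φ ⇒ fF
  𝕋 : Fm B Q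
  𝕋 = ¬F fF
  _∧F_ : Fm B Q → Fm B Q → Fm B Q
  φ ∧F ψ = ¬F (φ ⇒ ¬F ψ)
  _⇔_ : Fm B Q → Fm B Q → Fm B Q
  φ ⇔ ψ = (φ ⇒ ψ) ∧F (ψ ⇒ φ)
  dia : Tm B Q → Fm B Q → Fm B Q
  dia t φ = ¬F box t (¬F φ)

mutual
  data Fm⁻ (B Q : Set) : Set where
    fv⁻  : Q → Fm⁻ B Q
    _⇒⁻_ : Fm⁻ B Q → Fm⁻ B Q → Fm⁻ B Q
    fF⁻  : Fm⁻ B Q
    box⁻ : Tm⁻ B Q → Fm⁻ B Q → Fm⁻ B Q

  data Tm⁻ (B Q : Set) : Set where
    tv⁻   : B → Tm⁻ B Q
    _⨾⁻_  : Tm⁻ B Q → Tm⁻ B Q → Tm⁻ B Q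
    _⊕⁻_  : Tm⁻ B Q → Tm⁻ B Q → Tm⁻ B Q
    _⁺⁻   : Tm⁻ B Q → Tm⁻ B Q
    _¿⨾⁻_ : Fm⁻ B Q → Tm⁻ B Q → Tm⁻ B Q
    _⨾¿⁻_ : Tm⁻ B Q → Fm⁻ B Q → Tm⁻ B Q

module _ {B Q : Set} where
  infix 6 ¬⁻_
  infix 4 _⇔⁻_
  infixr 7 _∧⁻_
  ¬⁻_ : Fm⁻ B Q → Fm⁻ B Q
  ¬⁻ φ = φ ⇒⁻ fF⁻
  _∧⁻_ : Fm⁻ B Q → Fm⁻ B Q → Fm⁻ B Q
  φ ∧⁻ ψ = ¬⁻ (φ ⇒⁻ ¬⁻ ψ)
  _⇔⁻_ : Fm⁻ B Q → Fm⁻ B Q → Fm⁻ B Q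
  φ ⇔⁻ ψ = (φ ⇒⁻ ψ) ∧⁻ (ψ ⇒⁻ φ)

  instP⁻ : (ℕ → Fm⁻ B Q) → PropF → Fm⁻ B Q
  instP⁻ σ (ρv n)   = σ n
  instP⁻ σ (a ⇒ᴾ b) = instP⁻ σ a ⇒⁻ instP⁻ σ b
  instP⁻ σ ρF       = fF⁻

  data ⊢⁻_ : Fm⁻ B Q → Set where
    mp     : ∀ {φ ψ} → ⊢⁻ (φ ⇒⁻ ψ) → ⊢⁻ φ → ⊢⁻ ψ
    nec    : ∀ {φ} (t : Tm⁻ B Q) → ⊢⁻ φ → ⊢⁻ box⁻ t φ
    taut   : (τ : PropF) (σ : ℕ → Fm⁻ B Q) → Tautology τ → ⊢⁻ instP⁻ σ τ
    ax-seq : ∀ t u φ → ⊢⁻ (box⁻ (t ⨾⁻ u) φ ⇔⁻ box⁻ t (box⁻ u φ))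
    ax-cho : ∀ t u φ → ⊢⁻ (box⁻ (t ⊕⁻ u) φ ⇔⁻ (box⁻ t φ ∧⁻ box⁻ u φ))
    ax-unf : ∀ t φ → ⊢⁻ (box⁻ (t ⁺⁻) φ ⇔⁻ (box⁻ t φ ∧⁻ box⁻ t (box⁻ (t ⁺⁻) φ)))
    ax-ind : ∀ t φ → ⊢⁻ ((box⁻ t φ ∧⁻ box⁻ (t ⁺⁻) (φ ⇒⁻ box⁻ t φ)) ⇒⁻ box⁻ (t ⁺⁻) φ)
    ax-tl  : ∀ ψ t φ → ⊢⁻ (box⁻ (ψ ¿⨾⁻ t) φ ⇔⁻ (ψ ⇒⁻ box⁻ t φ))
    ax-tr  : ∀ t ψ φ → ⊢⁻ (box⁻ (t ⨾¿⁻ ψ) φ ⇔⁻ box⁻ t (ψ ⇒⁻ φ))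
    ax-K   : ∀ t φ ψ → ⊢⁻ (box⁻ t (φ ⇒⁻ ψ) ⇒⁻ (box⁻ t φ ⇒⁻ box⁻ t ψ))
    ax-löb : ∀ t φ → ⊢⁻ (box⁻ (t ⁺⁻) (box⁻ (t ⁺⁻) φ ⇒⁻ φ) ⇒⁻ box⁻ (t ⁺⁻) φ)

mutual
  data PFm : Set where
    pv   : ℕ → PFm
    _⇒ᵖ_ : PFm → PFm → PFm
    pF   : PFm
    boxᵖ : PTm → PFm → PFm

  data PTm : Set where
    ptv  : ℕ → PTm
    _⨾ᵖ_ : PTm → PTm → PTm
    _⊕ᵖ_ : PTm → PTm → PTm
    _⁺ᵖ  : PTm → PTm
    _¿ᵖ  : PFm → PTm

record RelModel : Set₁ where
  field
    W  : Set
    Rb : ℕ → W → W → Set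
    Vq : ℕ → W → Set

module _ (M : RelModel) where
  open RelModel M
  mutual
    sat : PFm → W → Set
    sat (pv n)     x = Vq n x
    sat (φ ⇒ᵖ ψ)   x = sat φ x → sat ψ x
    sat pF         x = ⊥
    sat (boxᵖ t φ) x = (y : W) → rel t x y → sat φ y

    rel : PTm → W → W → Set
    rel (ptv n)  x y = Rb n x y
    rel (t ⨾ᵖ u) x z = Σ W (λ y → rel t x y × rel u y z)
    rel (t ⊕ᵖ u) x y = rel t x y ⊎ rel u x y
    rel (t ⁺ᵖ)   x y = TransClosure (rel t) x y
    rel (φ ¿ᵖ)   x y = (x ≡ y) × sat φ x

-- Validity on REL, read classically (excluded middle assumed for the
-- metatheoretic truth values).
ValidREL : PFm → Set₁
ValidREL φ = ExcludedMiddle 0ℓ → (M : RelModel) → (x : RelModel.W M) → sat M φ x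

module _ {B Q : Set} (σB : ℕ → Tm B Q) (σQ : ℕ → Fm B Q) where
  mutual
    substF : PFm → Fm B Q
    substF (pv n)     = σQ n
    substF (φ ⇒ᵖ ψ)   = substF φ ⇒ substF ψ
    substF pF         = fF
    substF (boxᵖ t φ) = box (substT t) (substF φ)

    substT : PTm → Tm B Q
    substT (ptv n)  = σB n
    substT (t ⨾ᵖ u) = substT t ⨾ substT u
    substT (t ⊕ᵖ u) = substT t ⊕ substT u
    substT (t ⁺ᵖ)   = substT t ⁺
    substT (φ ¿ᵖ)   = substF φ ¿

module _ {B Q : Set} where
  data ⊢_ : Fm B Q → Set₁ where
    mp    : ∀ {φ ψ} → ⊢ (φ ⇒ ψ) → ⊢ φ → ⊢ ψ
    nec   : ∀ {φ} (t : Tm B Q) → ⊢ φ → ⊢ box t φ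
    valid : (χ : PFm) → ValidREL χ → (σB : ℕ → Tm B Q) (σQ : ℕ → Fm B Q)
            → ⊢ substF σB σQ χ
    ax-a      : ∀ t φ → ⊢ (box (t ᵃ) φ ⇔ box (box t fF ¿) φ)
    ax-id     : ∀ t φ → ⊢ (box (t ∩id) φ ⇔ box (dia (t ∩id) 𝕋 ¿) φ)
    ax-id-seq : ∀ t u φ → ⊢ (box ((t ⨾ u) ∩id) φ ⇔ box ((t ∩id) ⨾ (u ∩id)) φ)
    ax-id-cho : ∀ t u φ → ⊢ (box ((t ⊕ u) ∩id) φ ⇔ box ((t ∩id) ⊕ (u ∩id)) φ)
    ax-id-pl  : ∀ t φ → ⊢ (box ((t ⁺) ∩id) φ ⇔ box (t ∩id) φ)
    ax-id-a   : ∀ t φ → ⊢ (box ((t ᵃ) ∩id) φ ⇔ box (t ᵃ) φ)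
    ax-id-id  : ∀ t φ → ⊢ (box ((t ∩id) ∩id) φ ⇔ box (t ∩id) φ)
    ax-id-nid : ∀ t φ → ⊢ (box ((t ∩nid) ∩id) φ ⇔ 𝕋)
    ax-id-tst : ∀ ψ φ → ⊢ (box ((ψ ¿) ∩id) φ ⇔ box (ψ ¿) φ)
    ax-split  : ∀ t φ → ⊢ (box t φ ⇔ box ((t ∩id) ⊕ (t ∩nid)) φ)
    ax-nid-seq : ∀ t u φ → ⊢ (box ((t ⨾ u) ∩nid) φ
                   ⇔ box ((((t ∩nid) ⨾ (u ∩id)) ⊕ ((t ∩id) ⨾ (u ∩nid))) ⊕ ((t ∩nid) ⨾ (u ∩nid))) φ)
    ax-nid-cho : ∀ t u φ → ⊢ (box ((t ⊕ u) ∩nid) φ ⇔ box ((t ∩nid) ⊕ (u ∩nid)) φ)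
    ax-nid-pl  : ∀ t φ → ⊢ (box ((t ⁺) ∩nid) φ ⇔ box ((t ∩nid) ⁺) φ)
    ax-nid-a   : ∀ t φ → ⊢ (box ((t ᵃ) ∩nid) φ ⇔ 𝕋)
    ax-nid-id  : ∀ t φ → ⊢ (box ((t ∩id) ∩nid) φ ⇔ 𝕋)
    ax-nid-nid : ∀ t φ → ⊢ (box ((t ∩nid) ∩nid) φ ⇔ box (t ∩nid) φ)
    ax-nid-tst : ∀ ψ φ → ⊢ (box ((ψ ¿) ∩nid) φ ⇔ 𝕋)
    ax-löb     : ∀ t φ → ⊢ (box ((t ∩nid) ⁺) (box ((t ∩nid) ⁺) φ ⇒ φ) ⇒ box ((t ∩nid) ⁺) φ)

module _ {A P A' P' : Set} (π₁ : P' → A) (π₂ : A' → A) where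
  mutual
    Θ₀ : Fm⁻ A' (P ⊎ P') → Fm A P
    Θ₀ (fv⁻ (inj₁ p)) = fv p
    Θ₀ (fv⁻ (inj₂ p)) = dia (tv (π₁ p) ∩id) 𝕋
    Θ₀ (φ ⇒⁻ ψ)       = Θ₀ φ ⇒ Θ₀ ψ
    Θ₀ fF⁻            = fF
    Θ₀ (box⁻ t φ)     = box (Θ₀ᵗ t) (Θ₀ φ)

    Θ₀ᵗ : Tm⁻ A' (P ⊎ P') → Tm A P
    Θ₀ᵗ (tv⁻ a)    = tv (π₂ a) ∩nid
    Θ₀ᵗ (t ⨾⁻ u)   = Θ₀ᵗ t ⨾ Θ₀ᵗ u
    Θ₀ᵗ (t ⊕⁻ u)   = Θ₀ᵗ t ⊕ Θ₀ᵗ u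
    Θ₀ᵗ (t ⁺⁻)     = Θ₀ᵗ t ⁺
    Θ₀ᵗ (ψ ¿⨾⁻ t)  = (Θ₀ ψ ¿) ⨾ Θ₀ᵗ t
    Θ₀ᵗ (t ⨾¿⁻ ψ)  = Θ₀ᵗ t ⨾ (Θ₀ ψ ¿)

{-# OPTIONS --safe #-}
-- Θ₀ commutes with all connectives, so the rules of H⁻ are rules of H and every axiom of H⁻
-- other than Löb's translates to a substitution instance of a REL-valid PDL formula.
-- H has Löb's axiom only for terms (t ∩nid)⁺. A translated term Θ₀ᵗ t has empty reflexive
-- part, since atoms are sent to irreflexive terms and tests only occur composed with
-- translated terms; hence [Θ₀ᵗ t]χ ↔ [Θ₀ᵗ t ∩nid]χ is derivable, this equivalence lifts to
-- the transitive closures, and it transports Löb's axiom from Θ₀ᵗ t ∩nid to Θ₀ᵗ t.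
module Submission where

open import Defs
open import Data.Sum using (_⊎_)
open import Function.Bundles using (_⤖_; Bijection)

open import Axiom.DoubleNegationElimination using (em⇒dne)
open import Axiom.ExcludedMiddle using (ExcludedMiddle)
open import Data.Bool using (Bool; true; false)
open import Data.Nat using (ℕ; zero; suc)
open import Data.Product using (_×_; _,_; proj₂)
open import Data.Sum using (inj₁; inj₂; [_,_]′)
open import Function using (_∘_; id)
open import Level using (0ℓ)
open import Relation.Binary.Construct.Closure.Transitive using (TransClosure; [_]; _∷_)
open import Relation.Binary.PropositionalEquality using (_≡_; refl; cong₂; subst; sym)
open import Relation.Nullary using (¬_; Dec)
open import Relation.Nullary.Reflects using (Reflects; ofⁿ; _→-reflects_; invert)

-- Conjunction is encoded through → and F, so its semantics is ¬ (X → ¬ Y).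
_,ᶜ_ : {X Y : Set} → X → Y → ¬ (X → ¬ Y)
(x ,ᶜ y) k = k x y

module _ (em : ExcludedMiddle 0ℓ) {X Y : Set} where
  proj₁ᶜ : ¬ (X → ¬ Y) → X
  proj₁ᶜ h = em⇒dne em λ ¬x → h λ x _ → ¬x x

  proj₂ᶜ : ¬ (X → ¬ Y) → Y
  proj₂ᶜ h = em⇒dne em λ ¬y → h λ _ y → ¬y y

⁺-induction : {W : Set} (R : W → W → Set) (P : W → Set) {x : W}
  → (∀ y → R x y → P y)
  → (∀ y → TransClosure R x y → P y → ∀ z → R y z → P z)
  → ∀ y → TransClosure R x y → P y
⁺-induction R P base step y [ r ]    = base y r
⁺-induction R P base step y (r ∷ rs) =
  ⁺-induction R P (step _ [ r ] (base _ r)) (λ w rs′ → step w (r ∷ rs′)) y rs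

infixr 5 _⟶_
infixr 7 _∧ᵖ_
infix  4 _⇔ᵖ_

_⟶_ : PFm → PFm → PFm
_⟶_ = _⇒ᵖ_

¬ᵖ_ : PFm → PFm
¬ᵖ φ = φ ⟶ pF

_∧ᵖ_ : PFm → PFm → PFm
φ ∧ᵖ ψ = ¬ᵖ (φ ⟶ ¬ᵖ ψ)

_⇔ᵖ_ : PFm → PFm → PFm
φ ⇔ᵖ ψ = (φ ⟶ ψ) ∧ᵖ (ψ ⟶ φ)

p₀ p₁ p₂ : PFm
p₀ = pv 0
p₁ = pv 1
p₂ = pv 2

t₀ t₁ : PTm
t₀ = ptv 0
t₁ = ptv 1

box-⁺-unfoldᵖ : PFm
box-⁺-unfoldᵖ = boxᵖ (t₀ ⁺ᵖ) p₀ ⇔ᵖ (boxᵖ t₀ p₀ ∧ᵖ boxᵖ t₀ (boxᵖ (t₀ ⁺ᵖ) p₀))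

box-⁺-unfold-valid : ValidREL box-⁺-unfoldᵖ
box-⁺-unfold-valid em M x = (λ h → (λ y r → h y [ r ]) ,ᶜ (λ z r y rs → h y (r ∷ rs))) ,ᶜ fold
  where
  fold : sat M (boxᵖ t₀ p₀ ∧ᵖ boxᵖ t₀ (boxᵖ (t₀ ⁺ᵖ) p₀)) x → sat M (boxᵖ (t₀ ⁺ᵖ) p₀) x
  fold h y [ r ]    = proj₁ᶜ em h y r
  fold h y (r ∷ rs) = proj₂ᶜ em h _ r y rs

box-⁺-inductionᵖ : PFm
box-⁺-inductionᵖ = (boxᵖ t₀ p₀ ∧ᵖ boxᵖ (t₀ ⁺ᵖ) (p₀ ⟶ boxᵖ t₀ p₀)) ⟶ boxᵖ (t₀ ⁺ᵖ) p₀

box-⁺-induction-valid : ValidREL box-⁺-inductionᵖ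
box-⁺-induction-valid em M x h =
  ⁺-induction (rel M t₀) (sat M p₀) (proj₁ᶜ em h) (proj₂ᶜ em h)

box-⁺-invariantᵖ : PFm
box-⁺-invariantᵖ = boxᵖ (t₀ ⁺ᵖ) (p₀ ⟶ boxᵖ t₀ p₀) ⟶ boxᵖ (t₀ ⁺ᵖ) (p₀ ⟶ boxᵖ t₀ p₁)
                  ⟶ (p₀ ⟶ boxᵖ t₀ p₀) ⟶ (p₀ ⟶ boxᵖ t₀ p₁) ⟶ p₀ ⟶ boxᵖ (t₀ ⁺ᵖ) p₁

box-⁺-invariant-valid : ValidREL box-⁺-invariantᵖ
box-⁺-invariant-valid em M x stays⁺ yields⁺ stays yields i y rs =
  proj₂ (⁺-induction (rel M t₀) (λ w → sat M p₀ w × sat M p₁ w)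
           (λ y r → stays i y r , yields i y r)
           (λ y rs (iy , _) z r → stays⁺ y rs iy z r , yields⁺ y rs iy z r) y rs)

toP : PropF → PFm
toP (ρv n)   = pv n
toP (σ ⇒ᴾ τ) = toP σ ⟶ toP τ
toP ρF       = pF

module _ (em : ExcludedMiddle 0ℓ) (M : RelModel) (x : RelModel.W M) where
  truthValue : ℕ → Bool
  truthValue n = Dec.does (em {RelModel.Vq M n x})

  toP-reflects : ∀ τ → Reflects (sat M (toP τ) x) (evalP truthValue τ)
  toP-reflects (ρv n)   = Dec.proof (em {RelModel.Vq M n x})
  toP-reflects ρF       = ofⁿ id
  -- Splitting on the antecedent makes `if a then b else true` agree with `not a ∨ b`.
  toP-reflects (σ ⇒ᴾ τ) with evalP truthValue σ | toP-reflects σ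
  ... | true  | rσ = rσ →-reflects toP-reflects τ
  ... | false | rσ = rσ →-reflects toP-reflects τ

tautology-valid : ∀ τ → Tautology τ → ValidREL (toP τ)
tautology-valid τ τ-taut em M x =
  invert (subst (Reflects _) (τ-taut (truthValue em M x)) (toP-reflects em M x τ))

infixr 5 _∷ˢ_
_∷ˢ_ : {X : Set} → X → (ℕ → X) → ℕ → X
(x ∷ˢ σ) zero    = x
(x ∷ˢ σ) (suc n) = σ n

module _ {B Q : Set} where
  private variable
    φ ψ χ : Fm B Q
    t u   : Tm B Q

  -- B may be empty, so unused term variables of a schema are sent to the test F?.
  unusedᵗ : ℕ → Tm B Q
  unusedᵗ _ = fF ¿

  unusedᶠ : ℕ → Fm B Q
  unusedᶠ _ = fF

  mp₂ : ⊢ (φ ⇒ ψ ⇒ χ) → ⊢ φ → ⊢ ψ → ⊢ χ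
  mp₂ d e f = mp (mp d e) f

  ⊢𝕋 : ⊢ 𝕋 {B} {Q}
  ⊢𝕋 = valid (¬ᵖ pF) (λ _ _ _ → id) unusedᵗ unusedᶠ

  ⇔-to : ⊢ (φ ⇔ ψ) → ⊢ (φ ⇒ ψ)
  ⇔-to {φ} {ψ} = mp (valid ((p₀ ⇔ᵖ p₁) ⟶ p₀ ⟶ p₁) (λ em _ _ → proj₁ᶜ em)
                          unusedᵗ (φ ∷ˢ ψ ∷ˢ unusedᶠ))

  ⇔-from : ⊢ (φ ⇔ ψ) → ⊢ (ψ ⇒ φ)
  ⇔-from {φ} {ψ} = mp (valid ((p₀ ⇔ᵖ p₁) ⟶ p₁ ⟶ p₀) (λ em _ _ → proj₂ᶜ em)
                            unusedᵗ (φ ∷ˢ ψ ∷ˢ unusedᶠ))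

  ⇔-elimʳ : ⊢ (φ ⇔ ψ) → ⊢ ψ → ⊢ φ
  ⇔-elimʳ e = mp (⇔-from e)

  ∧-intro : ⊢ φ → ⊢ ψ → ⊢ (φ ∧F ψ)
  ∧-intro {φ} {ψ} = mp₂ (valid (p₀ ⟶ p₁ ⟶ p₀ ∧ᵖ p₁) (λ _ _ _ → _,ᶜ_)
                               unusedᵗ (φ ∷ˢ ψ ∷ˢ unusedᶠ))

  ⇒-trans : ⊢ (φ ⇒ ψ) → ⊢ (ψ ⇒ χ) → ⊢ (φ ⇒ χ)
  ⇒-trans {φ} {ψ} {χ} = mp₂ (valid ((p₀ ⟶ p₁) ⟶ (p₁ ⟶ p₂) ⟶ p₀ ⟶ p₂)
                                   (λ _ _ _ f g → g ∘ f) unusedᵗ (φ ∷ˢ ψ ∷ˢ χ ∷ˢ unusedᶠ))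

  ⇒-antitoneˡ : ⊢ (ψ ⇒ φ) → ⊢ ((φ ⇒ χ) ⇒ (ψ ⇒ χ))
  ⇒-antitoneˡ {ψ} {φ} {χ} = mp (valid ((p₁ ⟶ p₀) ⟶ (p₀ ⟶ p₂) ⟶ p₁ ⟶ p₂)
                                      (λ _ _ _ f g → g ∘ f) unusedᵗ (φ ∷ˢ ψ ∷ˢ χ ∷ˢ unusedᶠ))

  box-K : ∀ t φ ψ → ⊢ (box t (φ ⇒ ψ) ⇒ (box t φ ⇒ box t ψ))
  box-K t φ ψ = valid (boxᵖ t₀ (p₀ ⟶ p₁) ⟶ boxᵖ t₀ p₀ ⟶ boxᵖ t₀ p₁)
                      (λ _ _ _ f g y r → f y r (g y r)) (t ∷ˢ unusedᵗ) (φ ∷ˢ ψ ∷ˢ unusedᶠ)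

  box-mono : ∀ t → ⊢ (φ ⇒ ψ) → ⊢ (box t φ ⇒ box t ψ)
  box-mono t φ⇒ψ = mp (box-K t _ _) (nec t φ⇒ψ)

  box-⨾ : ∀ t u φ → ⊢ (box (t ⨾ u) φ ⇔ box t (box u φ))
  box-⨾ t u φ = valid (boxᵖ (t₀ ⨾ᵖ t₁) p₀ ⇔ᵖ boxᵖ t₀ (boxᵖ t₁ p₀))
                      (λ _ _ _ → (λ h y r z r′ → h z (y , r , r′))
                              ,ᶜ (λ { h z (y , r , r′) → h y r z r′ }))
                      (t ∷ˢ u ∷ˢ unusedᵗ) (φ ∷ˢ unusedᶠ)

  box-⊕ : ∀ t u φ → ⊢ (box (t ⊕ u) φ ⇔ (box t φ ∧F box u φ))
  box-⊕ t u φ = valid (boxᵖ (t₀ ⊕ᵖ t₁) p₀ ⇔ᵖ (boxᵖ t₀ p₀ ∧ᵖ boxᵖ t₁ p₀))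
                      (λ em _ _ → (λ h → (λ y → h y ∘ inj₁) ,ᶜ (λ y → h y ∘ inj₂))
                               ,ᶜ (λ h y → [ proj₁ᶜ em h y , proj₂ᶜ em h y ]′))
                      (t ∷ˢ u ∷ˢ unusedᵗ) (φ ∷ˢ unusedᶠ)

  ⇔-box-⊕-dropˡ : ⊢ (φ ⇔ box (t ⊕ u) ψ) → ⊢ box t ψ → ⊢ (φ ⇔ box u ψ)
  ⇔-box-⊕-dropˡ {φ} {t} {u} {ψ} = mp₂ (valid
    ((p₀ ⇔ᵖ boxᵖ (t₀ ⊕ᵖ t₁) p₁) ⟶ boxᵖ t₀ p₁ ⟶ (p₀ ⇔ᵖ boxᵖ t₁ p₁))
    (λ em _ _ e ht → (λ a y r → proj₁ᶜ em e a y (inj₂ r))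
                  ,ᶜ (λ hu → proj₂ᶜ em e (λ y → [ ht y , hu y ]′)))
    (t ∷ˢ u ∷ˢ unusedᵗ) (φ ∷ˢ ψ ∷ˢ unusedᶠ))

  box-¿⨾ : ∀ ψ t φ → ⊢ (box ((ψ ¿) ⨾ t) φ ⇔ (ψ ⇒ box t φ))
  box-¿⨾ ψ t φ = valid (boxᵖ ((p₁ ¿ᵖ) ⨾ᵖ t₀) p₀ ⇔ᵖ (p₁ ⟶ boxᵖ t₀ p₀))
                       (λ _ _ x → (λ h q y r → h y (x , (refl , q) , r))
                               ,ᶜ (λ { h y (_ , (refl , q) , r) → h q y r }))
                       (t ∷ˢ unusedᵗ) (φ ∷ˢ ψ ∷ˢ unusedᶠ)

  box-⨾¿ : ∀ t ψ φ → ⊢ (box (t ⨾ (ψ ¿)) φ ⇔ box t (ψ ⇒ φ))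
  box-⨾¿ t ψ φ = valid (boxᵖ (t₀ ⨾ᵖ (p₁ ¿ᵖ)) p₀ ⇔ᵖ boxᵖ t₀ (p₁ ⟶ p₀))
                       (λ _ _ _ → (λ h y r q → h y (y , r , (refl , q)))
                               ,ᶜ (λ { h y (_ , r , (refl , q)) → h y r q }))
                       (t ∷ˢ unusedᵗ) (φ ∷ˢ ψ ∷ˢ unusedᶠ)

  box-⁺-unfold : ∀ t φ → ⊢ (box (t ⁺) φ ⇔ (box t φ ∧F box t (box (t ⁺) φ)))
  box-⁺-unfold t φ = valid box-⁺-unfoldᵖ box-⁺-unfold-valid (t ∷ˢ unusedᵗ) (φ ∷ˢ unusedᶠ)

  box-⁺-induction : ∀ t φ → ⊢ ((box t φ ∧F box (t ⁺) (φ ⇒ box t φ)) ⇒ box (t ⁺) φ)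
  box-⁺-induction t φ = valid box-⁺-inductionᵖ box-⁺-induction-valid (t ∷ˢ unusedᵗ) (φ ∷ˢ unusedᶠ)

  box-⁺⇒box : ⊢ (box (t ⁺) φ ⇒ box t φ)
  box-⁺⇒box {t} {φ} = valid (boxᵖ (t₀ ⁺ᵖ) p₀ ⟶ boxᵖ t₀ p₀) (λ _ _ _ h y r → h y [ r ])
                            (t ∷ˢ unusedᵗ) (φ ∷ˢ unusedᶠ)

  box-⁺⇒box-box-⁺ : ⊢ (box (t ⁺) φ ⇒ box t (box (t ⁺) φ))
  box-⁺⇒box-box-⁺ {t} {φ} = valid (boxᵖ (t₀ ⁺ᵖ) p₀ ⟶ boxᵖ t₀ (boxᵖ (t₀ ⁺ᵖ) p₀))
                                  (λ _ _ _ h z r y rs → h y (r ∷ rs))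
                                  (t ∷ˢ unusedᵗ) (φ ∷ˢ unusedᶠ)

  invariant⇒box-⁺ : ⊢ (φ ⇒ box t φ) → ⊢ (φ ⇒ box t ψ) → ⊢ (φ ⇒ box (t ⁺) ψ)
  invariant⇒box-⁺ {φ} {t} {ψ} stays yields =
    mp₂ (mp₂ (valid box-⁺-invariantᵖ box-⁺-invariant-valid (t ∷ˢ unusedᵗ) (φ ∷ˢ ψ ∷ˢ unusedᶠ))
             (nec (t ⁺) stays) (nec (t ⁺) yields))
        stays yields

  box-⁺-mono : (∀ χ → ⊢ (box t χ ⇒ box u χ)) → ⊢ (box (t ⁺) φ ⇒ box (u ⁺) φ)
  box-⁺-mono {t} {u} {φ} t⇒u =
    invariant⇒box-⁺ (⇒-trans box-⁺⇒box-box-⁺ (t⇒u _)) (⇒-trans box-⁺⇒box (t⇒u φ))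

  Löb : Tm B Q → Fm B Q → Fm B Q
  Löb t φ = box (t ⁺) (box (t ⁺) φ ⇒ φ) ⇒ box (t ⁺) φ

  Löb-transfer : (∀ χ → ⊢ (box t χ ⇔ box u χ)) → ⊢ Löb u φ → ⊢ Löb t φ
  Löb-transfer {t} {u} {φ} t⇔u löb =
    ⇒-trans (box-mono (t ⁺) (⇒-antitoneˡ u⁺⇒t⁺)) (⇒-trans t⁺⇒u⁺ (⇒-trans löb u⁺⇒t⁺))
    where
    t⁺⇒u⁺ : ∀ {χ} → ⊢ (box (t ⁺) χ ⇒ box (u ⁺) χ)
    t⁺⇒u⁺ = box-⁺-mono (⇔-to ∘ t⇔u)

    u⁺⇒t⁺ : ∀ {χ} → ⊢ (box (u ⁺) χ ⇒ box (t ⁺) χ)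
    u⁺⇒t⁺ = box-⁺-mono (⇔-from ∘ t⇔u)

module _ {A P A' P' : Set} (π₁ : P' → A) (π₂ : A' → A) where
  private
    Θ : Fm⁻ A' (P ⊎ P') → Fm A P
    Θ = Θ₀ π₁ π₂

    Θᵗ : Tm⁻ A' (P ⊎ P') → Tm A P
    Θᵗ = Θ₀ᵗ π₁ π₂

  box-Θ₀ᵗ-∩id : ∀ t φ → ⊢ box (Θᵗ t ∩id) φ
  box-Θ₀ᵗ-∩id (tv⁻ a)    φ = ⇔-elimʳ (ax-id-nid (tv (π₂ a)) φ) ⊢𝕋
  box-Θ₀ᵗ-∩id (t ⨾⁻ u)   φ =
    ⇔-elimʳ (ax-id-seq _ _ φ) (⇔-elimʳ (box-⨾ _ _ φ) (box-Θ₀ᵗ-∩id t _))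
  box-Θ₀ᵗ-∩id (t ⊕⁻ u)   φ =
    ⇔-elimʳ (ax-id-cho _ _ φ) (⇔-elimʳ (box-⊕ _ _ φ) (∧-intro (box-Θ₀ᵗ-∩id t φ) (box-Θ₀ᵗ-∩id u φ)))
  box-Θ₀ᵗ-∩id (t ⁺⁻)     φ = ⇔-elimʳ (ax-id-pl _ φ) (box-Θ₀ᵗ-∩id t φ)
  box-Θ₀ᵗ-∩id (ψ ¿⨾⁻ t)  φ =
    ⇔-elimʳ (ax-id-seq _ _ φ) (⇔-elimʳ (box-⨾ _ _ φ) (nec _ (box-Θ₀ᵗ-∩id t φ)))
  box-Θ₀ᵗ-∩id (t ⨾¿⁻ ψ)  φ =
    ⇔-elimʳ (ax-id-seq _ _ φ) (⇔-elimʳ (box-⨾ _ _ φ) (box-Θ₀ᵗ-∩id t _))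

  box-Θ₀ᵗ⇔box-∩nid : ∀ t χ → ⊢ (box (Θᵗ t) χ ⇔ box (Θᵗ t ∩nid) χ)
  box-Θ₀ᵗ⇔box-∩nid t χ = ⇔-box-⊕-dropˡ (ax-split (Θᵗ t) χ) (box-Θ₀ᵗ-∩id t χ)

  Θ₀-instP⁻ : ∀ σ (σB : ℕ → Tm A P) τ → Θ (instP⁻ σ τ) ≡ substF σB (Θ ∘ σ) (toP τ)
  Θ₀-instP⁻ σ σB (ρv n)    = refl
  Θ₀-instP⁻ σ σB (τ ⇒ᴾ τ′) = cong₂ _⇒_ (Θ₀-instP⁻ σ σB τ) (Θ₀-instP⁻ σ σB τ′)
  Θ₀-instP⁻ σ σB ρF        = refl

  Θ₀-sound : ∀ {φ} → ⊢⁻ φ → ⊢ Θ φ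
  Θ₀-sound (mp d e)       = mp (Θ₀-sound d) (Θ₀-sound e)
  Θ₀-sound (nec t d)      = nec (Θᵗ t) (Θ₀-sound d)
  Θ₀-sound (taut τ σ τ-taut) =
    subst ⊢_ (sym (Θ₀-instP⁻ σ unusedᵗ τ)) (valid (toP τ) (tautology-valid τ τ-taut) unusedᵗ (Θ ∘ σ))
  Θ₀-sound (ax-seq t u φ) = box-⨾ (Θᵗ t) (Θᵗ u) (Θ φ)
  Θ₀-sound (ax-cho t u φ) = box-⊕ (Θᵗ t) (Θᵗ u) (Θ φ)
  Θ₀-sound (ax-unf t φ)   = box-⁺-unfold (Θᵗ t) (Θ φ)
  Θ₀-sound (ax-ind t φ)   = box-⁺-induction (Θᵗ t) (Θ φ)
  Θ₀-sound (ax-tl ψ t φ)  = box-¿⨾ (Θ ψ) (Θᵗ t) (Θ φ)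
  Θ₀-sound (ax-tr t ψ φ)  = box-⨾¿ (Θᵗ t) (Θ ψ) (Θ φ)
  Θ₀-sound (ax-K t φ ψ)   = box-K (Θᵗ t) (Θ φ) (Θ ψ)
  Θ₀-sound (ax-löb t φ)   = Löb-transfer (box-Θ₀ᵗ⇔box-∩nid t) (ax-löb (Θᵗ t) (Θ φ))

-- Only the underlying maps of π₁ and π₂ matter.
lemma2 : (A P A' P' : Set) (π₁ : P' ⤖ A) (π₂ : A' ⤖ A) (φ : Fm⁻ A' (P ⊎ P'))
    → ⊢⁻ φ → ⊢ Θ₀ (Bijection.to π₁) (Bijection.to π₂) φ
lemma2 A P A' P' π₁ π₂ φ = Θ₀-sound (Bijection.to π₁) (Bijection.to π₂)
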